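{- Let $k \ge 4$ be an integer and let $D$ be a $k$-partite tournament. Then the niche graph $\mathcal{N}(D)$ is connected.
   Context: A $k$-partite tournament is an orientation of a complete $k$-partite graph (with $k$ nonempty partite sets): for any two vertices in different partite sets exactly one of the arcs $(u,v)$, $(v,u)$ is present, and there are no arcs inside a partite set. The niche graph $\mathcal{N}(D)$ of a digraph $D$ has vertex set $V(D)$, and two distinct vertices $u,v$ are adjacent iff there is $w\in V(D)$ with $(u,w),(v,w)\in A(D)$, or there is $w \in V(D)$ with $(w,u),(w,v)\in A(D)$. -}

module Defs where

open import Data.Nat using (ℕ)
open import Data.Fin using (Fin)
open import Data.Bool using (Bool; true; not)
open import Data.Product using (Σ; ∃; _×_; _,_)
open import Data.Sum using (_⊎_)
open import Relation.Binary.PropositionalEquality using (_≡_; _≢_)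
open import Relation.Nullary using (¬_)
open import Relation.Binary.Construct.Closure.ReflexiveTransitive using (Star)

record Digraph (n : ℕ) : Set where
  field
    arc : Fin n → Fin n → Bool

open Digraph public

Arc : ∀ {n} → Digraph n → Fin n → Fin n → Set
Arc D u v = arc D u v ≡ true

record IsMultipartiteTournament {n : ℕ} (k : ℕ) (D : Digraph n) : Set where
  field
    part          : Fin n → Fin k
    part-nonempty : ∀ (i : Fin k) → ∃ λ v → part v ≡ i
    no-inner-arc  : ∀ u v → part u ≡ part v → ¬ Arc D u v
    orient        : ∀ u v → part u ≢ part v → arc D u v ≡ not (arc D v u)

IsKPartiteTournament : ∀ {n} → ℕ → Digraph n → Set
IsKPartiteTournament k D = IsMultipartiteTournament k D

NicheAdj : ∀ {n} → Digraph n → Fin n → Fin n → Set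
NicheAdj D u v =
  u ≢ v × ((∃ λ w → Arc D u w × Arc D v w) ⊎ (∃ λ w → Arc D w u × Arc D w v))

Connected : ∀ {n} → (Fin n → Fin n → Set) → Set
Connected {n} E = ∀ (u v : Fin n) → Star E u v

NicheGraphConnected : ∀ {n} → Digraph n → Set
NicheGraphConnected D = Connected (NicheAdj D)

-- Four vertices from four distinct parts span a tournament, and in a tournament an arc u → v
-- is bridged by any third vertex w through a common prey, a common predator or the transitive
-- triangle u → w → v, unless u → v → w → u. If two third vertices w, x both close directed
-- triangles with u → v, then (say w → x) the walk u — x — w — v works: w preys on u and x,
-- v preys on x and w, and x is prey of both w and v. With at least four parts, vertices in
-- different parts extend to such a quadruple, and vertices in one part meet via a third part.
module Submission where

open import Defs
open import Data.Nat using (ℕ; _≤_; _+_; suc; s≤s)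
open import Data.Fin using (Fin; zero; suc; _≟_; punchIn; punchOut)
open import Data.Fin.Properties using (punchIn-injective; punchInᵢ≢i; punchIn-punchOut)
open import Data.Bool using (true; false; not)
open import Data.Product using (_×_; _,_; proj₁; proj₂)
open import Data.Sum using (_⊎_; inj₁; inj₂)
open import Function using (_∘_)
open import Relation.Binary.PropositionalEquality using (_≡_; _≢_; refl; sym; trans; ≢-sym)
open import Relation.Nullary using (¬_; yes; no)
open import Relation.Binary.Construct.Closure.ReflexiveTransitive using (Star; ε; _◅_; _◅◅_; reverse)

≡not⇒either-true : ∀ {b c} → b ≡ not c → b ≡ true ⊎ c ≡ true
≡not⇒either-true {true}          _  = inj₁ refl
≡not⇒either-true {false} {true}  _  = inj₂ refl
≡not⇒either-true {false} {false} ()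

-- punchIn₂ a≢b enumerates Fin (2 + n) without a and b.
punchIn₂ : ∀ {n} {a b : Fin (suc (suc n))} → a ≢ b → Fin n → Fin (suc (suc n))
punchIn₂ {a = a} a≢b = punchIn a ∘ punchIn (punchOut a≢b)

module _ {n} {a b : Fin (suc (suc n))} (a≢b : a ≢ b) where

  punchIn₂-injective : ∀ {i j} → punchIn₂ a≢b i ≡ punchIn₂ a≢b j → i ≡ j
  punchIn₂-injective = punchIn-injective _ _ _ ∘ punchIn-injective _ _ _

  punchIn₂≢ˡ : ∀ j → punchIn₂ a≢b j ≢ a
  punchIn₂≢ˡ j = punchInᵢ≢i a _

  punchIn₂≢ʳ : ∀ j → punchIn₂ a≢b j ≢ b
  punchIn₂≢ʳ j eq = punchInᵢ≢i (punchOut a≢b) j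
    (punchIn-injective a _ _ (trans eq (sym (punchIn-punchOut a≢b))))

module NicheWalks {n : ℕ} (D : Digraph n) (loopless : ∀ u → ¬ Arc D u u) where

  Walk : Fin n → Fin n → Set
  Walk = Star (NicheAdj D)

  Comparable : Fin n → Fin n → Set
  Comparable u v = Arc D u v ⊎ Arc D v u

  arc⇒≢ : ∀ {u v} → Arc D u v → u ≢ v
  arc⇒≢ {u} uv refl = loopless u uv

  commonPrey : ∀ {u v w} → u ≢ v → Arc D u w → Arc D v w → NicheAdj D u v
  commonPrey u≢v uw vw = u≢v , inj₁ (_ , uw , vw)

  commonPredator : ∀ {u v w} → u ≢ v → Arc D w u → Arc D w v → NicheAdj D u v
  commonPredator u≢v wu wv = u≢v , inj₂ (_ , wu , wv)

  nicheAdj-sym : ∀ {u v} → NicheAdj D u v → NicheAdj D v u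
  nicheAdj-sym (u≢v , inj₁ (w , uw , vw)) = commonPrey (≢-sym u≢v) vw uw
  nicheAdj-sym (u≢v , inj₂ (w , wu , wv)) = commonPredator (≢-sym u≢v) wv wu

  transitiveTriple-walk : ∀ {u v w} → Arc D u w → Arc D w v → Arc D u v → Walk u v
  transitiveTriple-walk uw wv uv =
    commonPrey (arc⇒≢ uw) uv wv ◅ commonPredator (arc⇒≢ wv) uw uv ◅ ε

  walk-or-3-cycle : ∀ {u v w} → Arc D u v → Comparable u w → Comparable v w →
                    Walk u v ⊎ (Arc D v w × Arc D w u)
  walk-or-3-cycle uv (inj₁ uw) (inj₁ vw) = inj₁ (commonPrey (arc⇒≢ uv) uw vw ◅ ε)
  walk-or-3-cycle uv (inj₁ uw) (inj₂ wv) = inj₁ (transitiveTriple-walk uw wv uv)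
  walk-or-3-cycle uv (inj₂ wu) (inj₁ vw) = inj₂ (vw , wu)
  walk-or-3-cycle uv (inj₂ wu) (inj₂ wv) = inj₁ (commonPredator (arc⇒≢ uv) wu wv ◅ ε)

  two-3-cycles-walk : ∀ {u v w x} → Arc D v w → Arc D w u → Arc D v x → Arc D x u →
                      Arc D w x → Walk u v
  two-3-cycles-walk vw wu vx xu wx =
    commonPredator (≢-sym (arc⇒≢ xu)) wu wx ◅
    commonPredator (≢-sym (arc⇒≢ wx)) vx vw ◅
    commonPrey (≢-sym (arc⇒≢ vw)) wx vx ◅ ε

  arc-walk : ∀ {u v w x} → Arc D u v →
             Comparable u w → Comparable v w → Comparable u x → Comparable v x →
             Comparable w x → Walk u v
  arc-walk uv uw vw ux vx wx with walk-or-3-cycle uv uw vw | walk-or-3-cycle uv ux vx | wx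
  ... | inj₁ walk | _ | _ = walk
  ... | inj₂ _ | inj₁ walk | _ = walk
  ... | inj₂ (vw′ , wu) | inj₂ (vx′ , xu) | inj₁ w→x = two-3-cycles-walk vw′ wu vx′ xu w→x
  ... | inj₂ (vw′ , wu) | inj₂ (vx′ , xu) | inj₂ x→w = two-3-cycles-walk vx′ xu vw′ wu x→w

  tournament₄-walk : ∀ {u v w x} → Comparable u v →
                     Comparable u w → Comparable v w → Comparable u x → Comparable v x →
                     Comparable w x → Walk u v
  tournament₄-walk (inj₁ uv) uw vw ux vx wx = arc-walk uv uw vw ux vx wx
  tournament₄-walk (inj₂ vu) uw vw ux vx wx =
    reverse nicheAdj-sym (arc-walk vu vw uw vx ux wx)

module _ {k n} {D : Digraph n} (T : IsMultipartiteTournament k D) where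
  open IsMultipartiteTournament T

  multipartite-loopless : ∀ u → ¬ Arc D u u
  multipartite-loopless u = no-inner-arc u u refl

  open NicheWalks D multipartite-loopless

  comparable : ∀ {u v} → part u ≢ part v → Comparable u v
  comparable {u} {v} pu≢pv = ≡not⇒either-true (orient u v pu≢pv)

  representative : Fin k → Fin n
  representative i = proj₁ (part-nonempty i)

  part-representative : ∀ i → part (representative i) ≡ i
  part-representative i = proj₂ (part-nonempty i)

module _ {m n} {D : Digraph n} (T : IsMultipartiteTournament (4 + m) D) where
  open IsMultipartiteTournament T
  open NicheWalks D (multipartite-loopless T)

  apart-walk : ∀ {u v} → part u ≢ part v → Walk u v
  apart-walk {u} {v} pu≢pv =
    tournament₄-walk (comparable T pu≢pv)
      (comparable T (u-apart zero)) (comparable T (v-apart zero))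
      (comparable T (u-apart (suc zero))) (comparable T (v-apart (suc zero)))
      (comparable T others-apart)
    where
    other : Fin (2 + m) → Fin n
    other = representative T ∘ punchIn₂ pu≢pv

    part-other : ∀ j → part (other j) ≡ punchIn₂ pu≢pv j
    part-other j = part-representative T (punchIn₂ pu≢pv j)

    u-apart : ∀ j → part u ≢ part (other j)
    u-apart j eq = punchIn₂≢ˡ pu≢pv j (trans (sym (part-other j)) (sym eq))

    v-apart : ∀ j → part v ≢ part (other j)
    v-apart j eq = punchIn₂≢ʳ pu≢pv j (trans (sym (part-other j)) (sym eq))

    others-apart : part (other zero) ≢ part (other (suc zero))
    others-apart eq with punchIn₂-injective pu≢pv
                           (trans (sym (part-other zero)) (trans eq (part-other (suc zero))))
    ... | ()

  niche-connected : NicheGraphConnected D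
  niche-connected u v with part u ≟ part v
  ... | no pu≢pv = apart-walk pu≢pv
  ... | yes pu≡pv = apart-walk pu≢pz ◅◅ apart-walk (pu≢pz ∘ trans pu≡pv ∘ sym)
    where
    z : Fin n
    z = representative T (punchIn (part u) zero)

    pu≢pz : part u ≢ part z
    pu≢pz eq = punchInᵢ≢i (part u) zero (trans (sym (part-representative T _)) (sym eq))

theorem2p6 : (k : ℕ) → 4 ≤ k → (n : ℕ) → (D : Digraph n) →
    IsKPartiteTournament k D → NicheGraphConnected D
theorem2p6 (suc (suc (suc (suc m)))) (s≤s (s≤s (s≤s (s≤s _)))) n D T = niche-connected T
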